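{- Let $\mathcal{C}$ be the family of circuits of a matroid $\mathbb{M}$ on ground set $V$, and let $h=\Phi_{\mathcal{C}}$. Then $\mathbb{T}_h(X)=\mathrm{cl}_{\mathbb{M}}(X)$ for all $X\subseteq V$.
   Context: For $B\subseteq V$, $v\in V\setminus B$, the definite Horn clause $B\to v$ is the Boolean function (on subsets of $V$) whose true sets are the $T$ with $B\not\subseteq T$ or $B\cup\{v\}\subseteq T$. For a hypergraph $\mathcal{H}\subseteq 2^V$, $\Phi_{\mathcal{H}}=\bigwedge_{H\in\mathcal{H}}\bigwedge_{v\in H}((H\setminus\{v\})\to v)$. For a definite Horn function $h$ (conjunction of definite Horn clauses), the true sets are closed under intersection and contain $V$, and $\mathbb{T}_h(X)$ is the smallest true set of $h$ containing $X$. $\mathrm{cl}_{\mathbb{M}}(X)=\{v\in V: \mathrm{rank}_{\mathbb{M}}(X\cup\{v\})=\mathrm{rank}_{\mathbb{M}}(X)\}$ is the matroid closure. -}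

module Defs where

open import Data.Nat using (ℕ; _≤_; _<_; _+_)
open import Data.Nat.Properties using (_≟_)
open import Data.Fin using (Fin)
open import Data.Fin.Subset using (Subset; _∈_; _⊆_; _⊂_; _∪_; _∩_; _-_; ⁅_⁆; ∣_∣)
open import Data.Vec using (tabulate)
open import Data.Product using (_×_)
open import Data.Sum using (_⊎_)
open import Relation.Nullary using (¬_; does)

record Matroid (n : ℕ) : Set where
  field
    rank        : Subset n → ℕ
    rank-bound  : ∀ X → rank X ≤ ∣ X ∣
    rank-mono   : ∀ X Y → X ⊆ Y → rank X ≤ rank Y
    rank-submod : ∀ X Y → rank (X ∪ Y) + rank (X ∩ Y) ≤ rank X + rank Y

open Matroid public

Dependent : ∀ {n} → Matroid n → Subset n → Set
Dependent M X = rank M X < ∣ X ∣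

Circuit : ∀ {n} → Matroid n → Subset n → Set
Circuit M C = Dependent M C × (∀ D → D ⊂ C → ¬ Dependent M D)

cl : ∀ {n} → Matroid n → Subset n → Subset n
cl M X = tabulate (λ v → does (rank M (X ∪ ⁅ v ⁆) ≟ rank M X))

-- Boolean functions on subsets of V, represented by their set of true sets.
BoolFun : ℕ → Set₁
BoolFun n = Subset n → Set

HornClause : ∀ {n} → Subset n → Fin n → BoolFun n
HornClause B v T = (¬ (B ⊆ T)) ⊎ (B ∪ ⁅ v ⁆ ⊆ T)

-- Φ_𝓗 = ⋀_{H ∈ 𝓗} ⋀_{v ∈ H} ((H ∖ {v}) → v), for a hypergraph 𝓗 given
-- as a predicate on subsets of V.
Φ : ∀ {n} → (Subset n → Set) → BoolFun n
Φ 𝓗 T = ∀ H → 𝓗 H → ∀ v → v ∈ H → HornClause (H - v) v T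

-- T is 𝕋_h(X): the smallest true set of h containing X.
IsClosureOf : ∀ {n} → BoolFun n → Subset n → Subset n → Set
IsClosureOf h X T = h T × X ⊆ T × (∀ T′ → h T′ → X ⊆ T′ → T ⊆ T′)

-- A set T is a true set of Φ_𝒞 exactly when it is closed under circuits: C ∖ {v} ⊆ T for a
-- circuit C ∋ v forces v ∈ T. The closure cl X is closed in this sense, since v ∈ cl(C ∖ {v})
-- and adjoining a subset of cl X to X does not raise the rank. Conversely, every v ∈ cl Y ∖ Y
-- lies on a circuit C with C ∖ {v} ⊆ Y: the set Y ∪ {v} is dependent, so it contains a circuit;
-- if that circuit avoids v it lies in Y, and deleting one of its elements from Y preserves the
-- rank and hence v ∈ cl, so we recurse on a smaller set. For a true set T ⊇ X this gives
-- cl X ⊆ cl T ⊆ T.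

module Submission where

open import Defs
open import Data.Nat using (ℕ; suc; _+_; _≤_; _<_; _<?_; s≤s⁻¹)
open import Data.Nat.Properties using (module ≤-Reasoning; _≟_; ≤-reflexive; ≤-trans; ≤-antisym; ≤-<-trans; ≮⇒≥; n≮0; +-mono-≤; +-monoʳ-≤; +-cancelʳ-≤)
open import Data.Fin using (Fin; zero; suc)
open import Data.Fin.Properties using () renaming (_≟_ to _≟ᶠ_)
open import Data.Fin.Subset using (Subset; _∈_; _∉_; _⊆_; _⊂_; _∪_; _∩_; _─_; _-_; ⁅_⁆; ∣_∣; inside; outside)
open import Data.Fin.Subset.Properties using (_∈?_; _⊆?_; _⊂?_; nonempty?; anySubset?; Empty-unique; ∣⊥∣≡0; p⊆p∪q; q⊆p∪q; x∈p∪q⁻; x∈p∩q⁺; x∈⁅x⁆; x∈⁅y⁆⇒x≡y; x∈p∧x≢y⇒x∈p-y; x∈p∧x∉q⇒x∈p─q; p─q⊆p; p─⊥≡p; x∈p⇒p-x⊂p; p⊂q⇒p⊆q; p⊂q⇒∣p∣<∣q∣)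
open import Data.Fin.Subset.Induction using (Acc; acc; ⊂-wellFounded)
open import Data.Vec using (_∷_; tabulate; here; there)
open import Data.Vec.Properties using (lookup∘tabulate; []=⇒lookup; lookup⇒[]=)
open import Data.Bool using (true)
open import Data.Product using (Σ; _×_; _,_; proj₁)
open import Data.Sum using (inj₁; inj₂)
open import Data.Empty using (⊥-elim)
open import Relation.Nullary using (Dec; yes; no; does; contradiction)
open import Relation.Nullary.Decidable using (dec-true; _×-dec_)
open import Relation.Binary.PropositionalEquality using (_≡_; refl; sym; trans; cong; subst)

∪-lub : ∀ {n} {p q r : Subset n} → p ⊆ r → q ⊆ r → p ∪ q ⊆ r
∪-lub {p = p} {q} p⊆r q⊆r x∈p∪q with x∈p∪q⁻ p q x∈p∪q
... | inj₁ x∈p = p⊆r x∈p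
... | inj₂ x∈q = q⊆r x∈q

x∈p⇒⁅x⁆⊆p : ∀ {n} {x : Fin n} {p : Subset n} → x ∈ p → ⁅ x ⁆ ⊆ p
x∈p⇒⁅x⁆⊆p {x = x} x∈p y∈⁅x⁆ = subst (_∈ _) (sym (x∈⁅y⁆⇒x≡y x y∈⁅x⁆)) x∈p

p⊆p-x∪⁅x⁆ : ∀ {n} (p : Subset n) x → p ⊆ (p - x) ∪ ⁅ x ⁆
p⊆p-x∪⁅x⁆ p x {y} y∈p with y ≟ᶠ x
... | yes refl = q⊆p∪q _ _ (x∈⁅x⁆ y)
... | no  y≢x  = p⊆p∪q _ (x∈p∧x≢y⇒x∈p-y y∈p y≢x)

x∈p─q⇒x∉q : ∀ {n} {x : Fin n} (p q : Subset n) → x ∈ p ─ q → x ∉ q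
x∈p─q⇒x∉q (inside ∷ p)  (outside ∷ q) here        ()
x∈p─q⇒x∉q (_      ∷ p)  (_       ∷ q) (there x∈) (there x∈q) = x∈p─q⇒x∉q p q x∈ x∈q

p⊆q∪r⇒p─r⊆q : ∀ {n} {p q r : Subset n} → p ⊆ q ∪ r → p ─ r ⊆ q
p⊆q∪r⇒p─r⊆q {p = p} {q} {r} p⊆q∪r {x} x∈p─r with x∈p∪q⁻ q r (p⊆q∪r (p─q⊆p p r x∈p─r))
... | inj₁ x∈q = x∈q
... | inj₂ x∈r = contradiction x∈r (x∈p─q⇒x∉q p r x∈p─r)

p⊆q∪⁅x⁆∧x∉p⇒p⊆q : ∀ {n} {p q : Subset n} {x} → p ⊆ q ∪ ⁅ x ⁆ → x ∉ p → p ⊆ q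
p⊆q∪⁅x⁆∧x∉p⇒p⊆q p⊆q∪x x∉p y∈p =
  p⊆q∪r⇒p─r⊆q p⊆q∪x (x∈p∧x≢y⇒x∈p-y y∈p λ { refl → x∉p y∈p })

─-monoˡ-⊆ : ∀ {n} {p q r : Subset n} → p ⊆ q → p ─ r ⊆ q ─ r
─-monoˡ-⊆ {p = p} {r = r} p⊆q x∈p─r =
  x∈p∧x∉q⇒x∈p─q (p⊆q (p─q⊆p p r x∈p─r)) (x∈p─q⇒x∉q p r x∈p─r)

x∈p⇒∣p∣≡1+∣p-x∣ : ∀ {n} (p : Subset n) x → x ∈ p → ∣ p ∣ ≡ suc ∣ p - x ∣
x∈p⇒∣p∣≡1+∣p-x∣ (inside  ∷ p) zero    here      = cong (λ q → suc ∣ q ∣) (sym (p─⊥≡p p))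
x∈p⇒∣p∣≡1+∣p-x∣ (inside  ∷ p) (suc x) (there m) = cong suc (x∈p⇒∣p∣≡1+∣p-x∣ p x m)
x∈p⇒∣p∣≡1+∣p-x∣ (outside ∷ p) (suc x) (there m) = x∈p⇒∣p∣≡1+∣p-x∣ p x m

does≡true⇒ : ∀ {A : Set} (a? : Dec A) → does a? ≡ true → A
does≡true⇒ (yes a) _  = a
does≡true⇒ (no  _) ()

∈-tabulate-does⁺ : ∀ {n} {P : Fin n → Set} (P? : ∀ x → Dec (P x)) {x} →
                   P x → x ∈ tabulate (λ y → does (P? y))
∈-tabulate-does⁺ P? {x} px = lookup⇒[]= x _ (trans (lookup∘tabulate _ x) (dec-true (P? x) px))

∈-tabulate-does⁻ : ∀ {n} {P : Fin n → Set} (P? : ∀ x → Dec (P x)) {x} →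
                   x ∈ tabulate (λ y → does (P? y)) → P x
∈-tabulate-does⁻ P? {x} x∈ = does≡true⇒ (P? x) (trans (sym (lookup∘tabulate _ x)) ([]=⇒lookup x∈))

CircuitThrough : ∀ {n} → Matroid n → Fin n → Subset n → Set
CircuitThrough M v Y = Σ (Subset _) λ C → Circuit M C × v ∈ C × C - v ⊆ Y

circuitThrough-mono : ∀ {n} {M : Matroid n} {v Y Z} → Y ⊆ Z → CircuitThrough M v Y → CircuitThrough M v Z
circuitThrough-mono Y⊆Z (C , C-circ , v∈C , C-v⊆Y) = C , C-circ , v∈C , λ x∈ → Y⊆Z (C-v⊆Y x∈)

module _ {n : ℕ} (M : Matroid n) where

  private
    r : Subset n → ℕ
    r = rank M

  rank-mono-⊆ : ∀ {X Y} → X ⊆ Y → r X ≤ r Y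
  rank-mono-⊆ {X} {Y} = rank-mono M X Y

  ∈cl⁺ : ∀ {X v} → r (X ∪ ⁅ v ⁆) ≤ r X → v ∈ cl M X
  ∈cl⁺ {X} le = ∈-tabulate-does⁺ (λ v → r (X ∪ ⁅ v ⁆) ≟ r X)
                  (≤-antisym le (rank-mono-⊆ (p⊆p∪q _)))

  ∈cl⁻ : ∀ {X v} → v ∈ cl M X → r (X ∪ ⁅ v ⁆) ≤ r X
  ∈cl⁻ {X} v∈cl = ≤-reflexive (∈-tabulate-does⁻ (λ v → r (X ∪ ⁅ v ⁆) ≟ r X) v∈cl)

  X⊆cl : ∀ {X} → X ⊆ cl M X
  X⊆cl x∈X = ∈cl⁺ (rank-mono-⊆ (∪-lub (λ y∈X → y∈X) (x∈p⇒⁅x⁆⊆p x∈X)))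

  cl-mono : ∀ {X Y} → X ⊆ Y → cl M X ⊆ cl M Y
  cl-mono {X} {Y} X⊆Y {v} v∈clX = ∈cl⁺ (+-cancelʳ-≤ (r X) (r (Y ∪ ⁅ v ⁆)) (r Y) (begin
    r (Y ∪ ⁅ v ⁆) + r X                             ≤⟨ +-mono-≤ (rank-mono-⊆ Y∪v⊆) (rank-mono-⊆ X⊆∩) ⟩
    r (Y ∪ (X ∪ ⁅ v ⁆)) + r (Y ∩ (X ∪ ⁅ v ⁆))        ≤⟨ rank-submod M Y (X ∪ ⁅ v ⁆) ⟩
    r Y + r (X ∪ ⁅ v ⁆)                             ≤⟨ +-monoʳ-≤ (r Y) (∈cl⁻ v∈clX) ⟩
    r Y + r X                                       ∎))
    where
    open ≤-Reasoning
    Y∪v⊆ : Y ∪ ⁅ v ⁆ ⊆ Y ∪ (X ∪ ⁅ v ⁆)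
    Y∪v⊆ = ∪-lub (p⊆p∪q _) (λ x∈v → q⊆p∪q Y _ (q⊆p∪q X _ x∈v))
    X⊆∩ : X ⊆ Y ∩ (X ∪ ⁅ v ⁆)
    X⊆∩ x∈X = x∈p∩q⁺ (X⊆Y x∈X , p⊆p∪q _ x∈X)

  cl-⊆-of-spanning : ∀ {X Y} → Y ⊆ X → r X ≤ r Y → cl M X ⊆ cl M Y
  cl-⊆-of-spanning {X} {Y} Y⊆X rX≤rY {v} v∈clX = ∈cl⁺ (begin
    r (Y ∪ ⁅ v ⁆)  ≤⟨ rank-mono-⊆ (∪-lub (λ y∈Y → p⊆p∪q _ (Y⊆X y∈Y)) (q⊆p∪q X _)) ⟩
    r (X ∪ ⁅ v ⁆)  ≤⟨ ∈cl⁻ v∈clX ⟩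
    r X            ≤⟨ rX≤rY ⟩
    r Y            ∎)
    where open ≤-Reasoning

  rank-∪-⊆cl : ∀ {X} Y → Y ⊆ cl M X → r (X ∪ Y) ≤ r X
  rank-∪-⊆cl {X} Y = go Y (⊂-wellFounded Y)
    where
    go : ∀ Y → Acc _⊂_ Y → Y ⊆ cl M X → r (X ∪ Y) ≤ r X
    go Y (acc rec) Y⊆clX with nonempty? Y
    ... | no  Y-empty = rank-mono-⊆ (∪-lub (λ x∈X → x∈X)
                          (λ {y} y∈Y → contradiction (y , y∈Y) Y-empty))
    ... | yes (y , y∈Y) = begin
      r (X ∪ Y)                 ≤⟨ rank-mono-⊆ X∪Y⊆ ⟩
      r ((X ∪ (Y - y)) ∪ ⁅ y ⁆)  ≤⟨ ∈cl⁻ (cl-mono (p⊆p∪q _) (Y⊆clX y∈Y)) ⟩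
      r (X ∪ (Y - y))           ≤⟨ go (Y - y) (rec (x∈p⇒p-x⊂p y∈Y)) (λ x∈ → Y⊆clX (p─q⊆p Y _ x∈)) ⟩
      r X                       ∎
      where
      open ≤-Reasoning
      X∪Y⊆ : X ∪ Y ⊆ (X ∪ (Y - y)) ∪ ⁅ y ⁆
      X∪Y⊆ = ∪-lub (λ x∈X → p⊆p∪q _ (p⊆p∪q _ x∈X))
                   (λ x∈Y → ∪-lub (λ x∈ → p⊆p∪q _ (q⊆p∪q X _ x∈)) (q⊆p∪q _ _) (p⊆p-x∪⁅x⁆ Y y x∈Y))

  circuit⇒∈cl : ∀ {C v} → Circuit M C → v ∈ C → v ∈ cl M (C - v)
  circuit⇒∈cl {C} {v} (C-dep , C-minimal) v∈C = ∈cl⁺ (begin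
    r ((C - v) ∪ ⁅ v ⁆)  ≤⟨ rank-mono-⊆ (∪-lub (p─q⊆p C _) (x∈p⇒⁅x⁆⊆p v∈C)) ⟩
    r C                 ≤⟨ s≤s⁻¹ (subst (r C <_) (x∈p⇒∣p∣≡1+∣p-x∣ C v v∈C) C-dep) ⟩
    ∣ C - v ∣           ≤⟨ ≮⇒≥ (C-minimal (C - v) (x∈p⇒p-x⊂p v∈C)) ⟩
    r (C - v)           ∎)
    where open ≤-Reasoning

  cl-closed-under-circuits : ∀ {X C v} → Circuit M C → v ∈ C → C - v ⊆ cl M X → v ∈ cl M X
  cl-closed-under-circuits {X} {C} {v} C-circ v∈C C-v⊆clX =
    cl-⊆-of-spanning (p⊆p∪q _) (rank-∪-⊆cl (C - v) C-v⊆clX)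
      (cl-mono (q⊆p∪q X _) (circuit⇒∈cl C-circ v∈C))

  dependent⇒nonempty : ∀ {D} → Dependent M D → Σ (Fin n) (_∈ D)
  dependent⇒nonempty {D} D-dep with nonempty? D
  ... | yes x∈D   = x∈D
  ... | no  D-empty = contradiction (subst (r D <_) ∣D∣≡0 D-dep) n≮0
    where
    ∣D∣≡0 : ∣ D ∣ ≡ 0
    ∣D∣≡0 = trans (cong ∣_∣ (Empty-unique D-empty)) (∣⊥∣≡0 n)

  dependent⇒circuit : ∀ {D} → Dependent M D → Σ (Subset n) λ C → C ⊆ D × Circuit M C
  dependent⇒circuit {D} = go D (⊂-wellFounded D)
    where
    go : ∀ D → Acc _⊂_ D → Dependent M D → Σ (Subset n) λ C → C ⊆ D × Circuit M C
    go D (acc rec) D-dep with anySubset? (λ E → (E ⊂? D) ×-dec (r E <? ∣ E ∣))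
    ... | no  no-smaller-dep =
      D , (λ x∈D → x∈D) , D-dep , λ E E⊂D E-dep → no-smaller-dep (E , E⊂D , E-dep)
    ... | yes (E , E⊂D , E-dep) with go E (rec E⊂D) E-dep
    ...   | C , C⊆E , C-circ = C , (λ x∈C → p⊂q⇒p⊆q E⊂D (C⊆E x∈C)) , C-circ

  ∈cl-∉⇒dependent : ∀ {Y v} → v ∈ cl M Y → v ∉ Y → Dependent M (Y ∪ ⁅ v ⁆)
  ∈cl-∉⇒dependent {Y} {v} v∈clY v∉Y =
    ≤-<-trans (≤-trans (∈cl⁻ v∈clY) (rank-bound M Y))
              (p⊂q⇒∣p∣<∣q∣ (p⊆p∪q _ , v , q⊆p∪q Y _ (x∈⁅x⁆ v) , v∉Y))

  rank-remove-circuit-element : ∀ {Y C y} → Circuit M C → C ⊆ Y → y ∈ C → r Y ≤ r (Y - y)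
  rank-remove-circuit-element {Y} {C} {y} C-circ C⊆Y y∈C = begin
    r Y                  ≤⟨ rank-mono-⊆ (p⊆p-x∪⁅x⁆ Y y) ⟩
    r ((Y - y) ∪ ⁅ y ⁆)  ≤⟨ ∈cl⁻ (cl-mono (─-monoˡ-⊆ C⊆Y) (circuit⇒∈cl C-circ y∈C)) ⟩
    r (Y - y)            ∎
    where open ≤-Reasoning

  ∈cl⇒circuitThrough : ∀ {Y v} → v ∈ cl M Y → v ∉ Y → CircuitThrough M v Y
  ∈cl⇒circuitThrough {Y} = go Y (⊂-wellFounded Y)
    where
    go : ∀ Y {v} → Acc _⊂_ Y → v ∈ cl M Y → v ∉ Y → CircuitThrough M v Y
    go Y {v} (acc rec) v∈clY v∉Y with dependent⇒circuit (∈cl-∉⇒dependent v∈clY v∉Y)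
    ... | C , C⊆Y∪v , C-circ with v ∈? C
    ...   | yes v∈C = C , C-circ , v∈C , p⊆q∪r⇒p─r⊆q C⊆Y∪v
    ...   | no  v∉C with dependent⇒nonempty (proj₁ C-circ)
    ...     | y , y∈C = circuitThrough-mono {M = M} (p─q⊆p Y _)
                          (go (Y - y) (rec (x∈p⇒p-x⊂p (C⊆Y y∈C))) v∈cl[Y-y] (λ v∈ → v∉Y (p─q⊆p Y _ v∈)))
      where
      C⊆Y : C ⊆ Y
      C⊆Y = p⊆q∪⁅x⁆∧x∉p⇒p⊆q C⊆Y∪v v∉C
      v∈cl[Y-y] : v ∈ cl M (Y - y)
      v∈cl[Y-y] = cl-⊆-of-spanning (p─q⊆p Y _) (rank-remove-circuit-element C-circ C⊆Y y∈C) v∈clY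

HornClause-intro : ∀ {n} {B T : Subset n} {v} → (B ⊆ T → v ∈ T) → HornClause B v T
HornClause-intro {B = B} {T} B⊆T⇒v∈T with B ⊆? T
... | no  B⊈T = inj₁ B⊈T
... | yes B⊆T = inj₂ (∪-lub B⊆T (x∈p⇒⁅x⁆⊆p (B⊆T⇒v∈T B⊆T)))

HornClause-elim : ∀ {n} {B T : Subset n} {v} → HornClause B v T → B ⊆ T → v ∈ T
HornClause-elim (inj₁ B⊈T)     B⊆T = ⊥-elim (B⊈T B⊆T)
HornClause-elim {B = B} (inj₂ B∪v⊆T) _ = B∪v⊆T (q⊆p∪q B _ (x∈⁅x⁆ _))

lemma7 : ∀ {n : ℕ} (M : Matroid n) (X : Subset n) →
           IsClosureOf (Φ (Circuit M)) X (cl M X)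
lemma7 M X = cl-true , X⊆cl M , cl-least
  where
  cl-true : Φ (Circuit M) (cl M X)
  cl-true C C-circ v v∈C = HornClause-intro (cl-closed-under-circuits M C-circ v∈C)

  cl-least : ∀ T → Φ (Circuit M) T → X ⊆ T → cl M X ⊆ T
  cl-least T ΦT X⊆T {v} v∈clX with v ∈? T
  ... | yes v∈T = v∈T
  ... | no  v∉T with ∈cl⇒circuitThrough M (cl-mono M X⊆T v∈clX) v∉T
  ...   | C , C-circ , v∈C , C-v⊆T = HornClause-elim (ΦT C C-circ v v∈C) C-v⊆T
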